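{- Let $\mathcal N$ be a phylogenetic $X$-network with a coloring $c:E_T(\mathcal N)\to[kH]$ of its tree edges, let $S\subseteq X$ and $\chi:X\to2^{[kH]}$ be such that $(S,\chi)$ is colorful. Then for any distinct $x,y\in S$, any $(x,\chi)$-suitable set $F_{x,\chi}$ and any $(y,\chi)$-suitable set $F_{y,\chi}$ are disjoint.
   Context: A phylogenetic $X$-network $\mathcal N$ is a finite directed acyclic graph with a unique vertex of in-degree $0$ (the root), whose leaves (in-degree $1$, out-degree $0$) form the set $X$, and whose other vertices are tree vertices (in-degree $1$, out-degree $\ge2$) or reticulations (in-degree $\ge2$, out-degree $1$). Edges entering tree vertices are tree edges; $E_T(\mathcal N)$ is their set; $k$ and $H$ are positive integers. $(S,\chi)$ is colorful if for all $x,y\in S$, $\chi(x)\cap\chi(y)\ne\emptyset$ implies $x=y$. For $x\in X$, a set $F\subseteq E(\mathcal N)$ is $(x,\chi)$-suitable if $c(e)\in\chi(x)$ for each $e\in F\cap E_T(\mathcal N)$, $c(e_1)\ne c(e_2)$ for distinct $e_1,e_2\in F\cap E_T(\mathcal N)$, and for each $uv\in F$ there is a directed path from $v$ to $x$ in the subgraph of $\mathcal N$ induced by the endpoints of edges of $F$. -}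

module Defs where

open import Data.Nat using (ℕ; _≤_; _*_)
open import Data.Fin using (Fin)
open import Data.Fin.Subset using (Subset; _∈_; ∣_∣)
open import Data.Vec using (tabulate)
open import Data.Bool using (Bool; T)
open import Data.Product using (Σ; ∃; _×_; proj₁)
open import Data.Sum using (_⊎_)
open import Relation.Nullary using (¬_)
open import Relation.Binary.PropositionalEquality using (_≡_; _≢_)
open import Relation.Binary.Construct.Closure.ReflexiveTransitive using (Star)

record Digraph : Set where
  field
    n   : ℕ
    adj : Fin n → Fin n → Bool

  Vertex : Set
  Vertex = Fin n

  Edge : Vertex → Vertex → Set
  Edge u v = T (adj u v)

  indeg : Vertex → ℕ
  indeg v = ∣ tabulate (λ u → adj u v) ∣

  outdeg : Vertex → ℕ
  outdeg u = ∣ tabulate (λ v → adj u v) ∣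

  IsLeaf : Vertex → Set
  IsLeaf v = indeg v ≡ 1 × outdeg v ≡ 0

  IsTreeVertex : Vertex → Set
  IsTreeVertex v = indeg v ≡ 1 × 2 ≤ outdeg v

  IsReticulation : Vertex → Set
  IsReticulation v = 2 ≤ indeg v × outdeg v ≡ 1

  Acyclic : Set
  Acyclic = ∀ u v → Edge u v → ¬ Star Edge v u

record IsPhyloNetwork (N : Digraph) : Set where
  open Digraph N
  field
    acyclic : Acyclic
    root    : Vertex
    root-indeg : indeg root ≡ 0
    root-unique : ∀ v → indeg v ≡ 0 → v ≡ root
    classify : ∀ v → v ≢ root →
      IsLeaf v ⊎ (IsTreeVertex v ⊎ IsReticulation v)

module _ (N : Digraph) where
  open Digraph N

  Leaf : Set
  Leaf = Σ Vertex IsLeaf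

  EdgeSet : Set
  EdgeSet = Σ (Vertex → Vertex → Bool) (λ F → ∀ u v → T (F u v) → Edge u v)

  InF : EdgeSet → Vertex → Vertex → Set
  InF F u v = T (proj₁ F u v)

  Colorful : {m : ℕ} → (Leaf → Set) → (Leaf → Subset m) → Set
  Colorful S χ = ∀ x y → S x → S y →
    (∃ λ c → c ∈ χ x × c ∈ χ y) → proj₁ x ≡ proj₁ y

  -- The coloring is given as a function on all vertex pairs; only its values
  -- on tree edges (edges entering tree vertices) are ever used.
  Suitable : {m : ℕ} → (c : Vertex → Vertex → Fin m) →
             (Leaf → Subset m) → Leaf → EdgeSet → Set
  Suitable c χ x F =
      (∀ u v → InF F u v → IsTreeVertex v → c u v ∈ χ x)
    × (∀ u v u' v' → InF F u v → InF F u' v' → IsTreeVertex v → IsTreeVertex v' →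
         c u v ≡ c u' v' → u ≡ u' × v ≡ v')
    × (∀ u v → InF F u v → Star (InF F) v (proj₁ x))

{-# OPTIONS --safe #-}
-- Follow the path of F_x from the shared edge uv towards x.  Every vertex it
-- reaches is entered by an edge of both F_x and F_y.  If that vertex is a tree
-- vertex, the colour of the edge entering it lies in χ x ∩ χ y, contradicting
-- colourfulness.  Otherwise it is a reticulation: its unique out-edge must be
-- the next edge of both paths, so the shared edge moves one step forward.  The
-- path cannot end at the leaf x while sharing an edge with F_y, since F_y would
-- then have to end there too, i.e. x = y.
module Submission where

open import Defs
open import Data.Nat using (ℕ; _≤_; _<_; _*_; z≤n)
open import Data.Nat.Properties using (≤-<-trans; <⇒≢)
open import Data.Fin using (Fin)
open import Data.Fin.Properties using (_≟_)
open import Data.Fin.Subset using (Subset; _∈_; ∣_∣)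
open import Data.Fin.Subset.Properties using (x∈p⇒∣p-x∣<∣p∣; x∈p∧x≢y⇒x∈p-y)
open import Data.Vec using (tabulate)
open import Data.Vec.Properties using (lookup⇒[]=; lookup∘tabulate)
open import Data.Bool using (Bool; T)
open import Data.Bool.Properties using (T-≡)
open import Data.Product using (∃₂; _×_; _,_; proj₁; proj₂)
open import Data.Sum using (_⊎_; inj₁; inj₂)
open import Data.Empty using (⊥)
open import Function.Bundles using (Equivalence)
open import Relation.Nullary using (yes; no; contradiction)
open import Relation.Binary.PropositionalEquality using (_≡_; _≢_; refl; sym; trans; ≢-sym)
open import Relation.Binary.Construct.Closure.ReflexiveTransitive using (Star; ε; _◅_)

module _ {n : ℕ} where

  T⇒∈tabulate : (f : Fin n → Bool) {i : Fin n} → T (f i) → i ∈ tabulate f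
  T⇒∈tabulate f {i} t =
    lookup⇒[]= i (tabulate f) (trans (lookup∘tabulate f i) (Equivalence.to T-≡ t))

  x∈p⇒0<∣p∣ : {x : Fin n} {p : Subset n} → x ∈ p → 0 < ∣ p ∣
  x∈p⇒0<∣p∣ x∈p = ≤-<-trans z≤n (x∈p⇒∣p-x∣<∣p∣ x∈p)

  x∈p∧y∈p∧x≢y⇒1<∣p∣ : {x y : Fin n} {p : Subset n} →
                      x ∈ p → y ∈ p → x ≢ y → 1 < ∣ p ∣
  x∈p∧y∈p∧x≢y⇒1<∣p∣ x∈p y∈p x≢y =
    ≤-<-trans (x∈p⇒0<∣p∣ (x∈p∧x≢y⇒x∈p-y y∈p (≢-sym x≢y)))
              (x∈p⇒∣p-x∣<∣p∣ x∈p)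

  ∣p∣≡1∧x∈p∧y∈p⇒x≡y : {x y : Fin n} {p : Subset n} →
                      ∣ p ∣ ≡ 1 → x ∈ p → y ∈ p → x ≡ y
  ∣p∣≡1∧x∈p∧y∈p⇒x≡y {x} {y} ∣p∣≡1 x∈p y∈p with x ≟ y
  ... | yes x≡y = x≡y
  ... | no x≢y  = contradiction (sym ∣p∣≡1) (<⇒≢ (x∈p∧y∈p∧x≢y⇒1<∣p∣ x∈p y∈p x≢y))

module _ (N : Digraph) where
  open Digraph N

  edge⇒indeg≢0 : {u v : Vertex} → Edge u v → indeg v ≢ 0
  edge⇒indeg≢0 {v = v} uv indeg≡0 =
    <⇒≢ (x∈p⇒0<∣p∣ (T⇒∈tabulate (λ w → adj w v) uv)) (sym indeg≡0)

  edge⇒outdeg≢0 : {u v : Vertex} → Edge u v → outdeg u ≢ 0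
  edge⇒outdeg≢0 {u} uv outdeg≡0 =
    <⇒≢ (x∈p⇒0<∣p∣ (T⇒∈tabulate (adj u) uv)) (sym outdeg≡0)

  outdeg≡1⇒out-edge-unique : {u v w : Vertex} →
                             outdeg u ≡ 1 → Edge u v → Edge u w → v ≡ w
  outdeg≡1⇒out-edge-unique {u} outdeg≡1 uv uw =
    ∣p∣≡1∧x∈p∧y∈p⇒x≡y outdeg≡1 (T⇒∈tabulate (adj u) uv) (T⇒∈tabulate (adj u) uw)

  CommonTreeEdge : EdgeSet N → EdgeSet N → Set
  CommonTreeEdge F G = ∃₂ λ u v → InF N F u v × InF N G u v × IsTreeVertex v

module _ {N : Digraph} (isN : IsPhyloNetwork N) where
  open Digraph N
  open IsPhyloNetwork isN

  inner-vertex⇒tree-or-outdeg≡1 : {u v w : Vertex} → Edge u v → Edge v w →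
                                  IsTreeVertex v ⊎ outdeg v ≡ 1
  inner-vertex⇒tree-or-outdeg≡1 {v = v} uv vw with v ≟ root
  ... | yes refl = contradiction root-indeg (edge⇒indeg≢0 N uv)
  ... | no v≢root with classify v v≢root
  ... | inj₁ (_ , outdeg≡0)        = contradiction outdeg≡0 (edge⇒outdeg≢0 N vw)
  ... | inj₂ (inj₁ tree)           = inj₁ tree
  ... | inj₂ (inj₂ (_ , outdeg≡1)) = inj₂ outdeg≡1

  common-edge⇒common-tree-edge :
    (F G : EdgeSet N) {x y u v : Vertex} → outdeg x ≡ 0 → outdeg y ≡ 0 → x ≢ y →
    InF N F u v → InF N G u v → Star (InF N F) v x → Star (InF N G) v y →
    CommonTreeEdge N F G
  common-edge⇒common-tree-edge F G _ _ x≢y _ _ ε ε = contradiction refl x≢y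
  common-edge⇒common-tree-edge F G x-sink _ _ _ _ ε (vw ◅ _) =
    contradiction x-sink (edge⇒outdeg≢0 N (proj₂ G _ _ vw))
  common-edge⇒common-tree-edge F G _ y-sink _ _ _ (vw ◅ _) ε =
    contradiction y-sink (edge⇒outdeg≢0 N (proj₂ F _ _ vw))
  common-edge⇒common-tree-edge F G x-sink y-sink x≢y uv∈F uv∈G (vw∈F ◅ p) (vw′∈G ◅ q)
    with inner-vertex⇒tree-or-outdeg≡1 (proj₂ F _ _ uv∈F) (proj₂ F _ _ vw∈F)
  ... | inj₁ tree = _ , _ , uv∈F , uv∈G , tree
  ... | inj₂ outdeg≡1
    with outdeg≡1⇒out-edge-unique N outdeg≡1 (proj₂ F _ _ vw∈F) (proj₂ G _ _ vw′∈G)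
  ... | refl = common-edge⇒common-tree-edge F G x-sink y-sink x≢y vw∈F vw′∈G p q

lemma4p6 : (N : Digraph) → IsPhyloNetwork N →
    (k H : ℕ) → 1 ≤ k → 1 ≤ H →
    (c : Digraph.Vertex N → Digraph.Vertex N → Fin (k * H)) →
    (S : Leaf N → Set) → (χ : Leaf N → Subset (k * H)) →
    Colorful N S χ →
    (x y : Leaf N) → S x → S y → proj₁ x ≢ proj₁ y →
    (Fx Fy : EdgeSet N) → Suitable N c χ x Fx → Suitable N c χ y Fy →
    ∀ u v → InF N Fx u v → InF N Fy u v → ⊥
lemma4p6 N isN _ _ _ _ c _ _ colorful x y Sx Sy x≢y Fx Fy
         (χx-colours , _ , Fx-reaches-x) (χy-colours , _ , Fy-reaches-y) u v uv∈Fx uv∈Fy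
  with common-edge⇒common-tree-edge isN Fx Fy (proj₂ (proj₂ x)) (proj₂ (proj₂ y)) x≢y
         uv∈Fx uv∈Fy (Fx-reaches-x u v uv∈Fx) (Fy-reaches-y u v uv∈Fy)
... | u′ , v′ , e∈Fx , e∈Fy , tree =
  x≢y (colorful x y Sx Sy (c u′ v′ , χx-colours u′ v′ e∈Fx tree , χy-colours u′ v′ e∈Fy tree))
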